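{- Consider the generalized Sudoku problem with data $n, \pi_1, \pi_2, \pi_3, i_1, \ldots, i_k, g_{i_1}, \ldots, g_{i_k}$ and solution set $S(n,g)$, and let $x \in S(n, g)$. Then $S(n, g)$ equals the set of all $y \in \mathbb{Z}^{n^2}$ for which there exists a permutation $\tau$ of $\{1, \ldots, n^2\}$ such that $y = \tau(x)$, $\tau$ is $\pi_1$-consistent, $\pi_2$-$x$-consistent and $\pi_3$-$x$-consistent, and $\tau(i_l) = i_l$ for $l = 1, \ldots, k$.
   Context: For $y \in \mathbb{Z}^s$ write $y <> \mathbf{0}$ if every component of $y$ is nonzero. Let $n \ge 2$ and $s(n) = \sum_{i=1}^{n-1} i$. The $s(n) \times n$ matrix $A(n)$ is defined inductively: $A(1)$ is the empty matrix, and $A(m) = \begin{pmatrix} \mathbf{1}_{m-1} & -U_{m-1} \\ \mathbf{0}_{s(m-1)} & A(m-1) \end{pmatrix}$, where $\mathbf{1}_{m-1}$ is the all-ones column, $U_{m-1}$ the identity matrix and $\mathbf{0}_{s(m-1)}$ the zero column of length $s(m-1)$. Let $A$ be the $(n \cdot s(n)) \times n^2$ block-diagonal matrix whose $n$ diagonal blocks all equal $A(n)$. For a permutation $\pi$ of $\{1,\ldots,n^2\}$, $A_\pi$ is the matrix whose $j$-th column is the $\pi^{ -1}(j)$-th column of $A$. For a permutation $\tau$ and $x \in \mathbb{Z}^{n^2}$, $\tau(x) = (x_{\tau^{ -1}(1)}, \ldots, x_{\tau^{ -1}(n^2)})^T$. The constraint sets of $\pi$ are $cs_\pi(j) = \{\pi(i)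 \mid (j-1)n + 1 \le i \le jn\}$, $j=1,\ldots,n$. A permutation $\tau$ is $\pi$-consistent if $\tau(cs_\pi(j)) = cs_\pi(j)$ for all $j$, and $\pi$-$x$-consistent if $\{x_{\tau^{ -1}(i)} \mid i \in cs_\pi(j)\} = \{x_i \mid i \in cs_\pi(j)\}$ for all $j$. Generalized Sudoku problem: given permutations $\pi_1, \pi_2, \pi_3$ of $\{1, \ldots, n^2\}$, an integer $0 \le k \le n^2$, an index set $\{i_1, \ldots, i_k\} \subset \{1, \ldots, n^2\}$ and givens $g_{i_l} \in \mathbb{Z}$ with $1 \le g_{i_l} \le n$, its solution set is $S(n,g) = \{x \in \mathbb{Z}^{n^2} \mid 1 \le x_i \le n \ (i = 1,\ldots,n^2),\ A_{\pi_r}x <> \mathbf{0}\ (r = 1,2,3),\ x_{i_l} = g_{i_l}\ (l = 1, \ldots, k)\}$. -}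

module Defs where

import Data.Nat as ℕ
open ℕ using (ℕ; zero; suc)
open import Data.Fin as Fin using (Fin; zero; suc; splitAt; remQuot; quotient; remainder)
open import Data.Fin.Permutation using (Permutation′; _⟨$⟩ʳ_; _⟨$⟩ˡ_)
open import Data.Integer as ℤ using (ℤ; +_; -_; 0ℤ; 1ℤ)
open import Data.Sum using (_⊎_; inj₁; inj₂)
open import Data.Product using (Σ; _×_; _,_; proj₁; proj₂; ∃)
open import Relation.Binary.PropositionalEquality using (_≡_; _≢_)
open import Relation.Nullary using (yes; no)
open import Function.Bundles using (_⇔_)

s : ℕ → ℕ
s zero = 0
s (suc m) = m ℕ.+ s m

Matrix : ℕ → ℕ → Set
Matrix r c = Fin r → Fin c → ℤ

δ : ∀ {m} → Fin m → Fin m → ℤ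
δ i j with i Fin.≟ j
... | yes _ = 1ℤ
... | no _ = 0ℤ

-- A(m) : s(m) × m matrix, defined inductively:
-- A(m+1) = [ 1_m  -U_m ; 0_{s(m)}  A(m) ]  (rows split as m + s(m), columns as 1 + m)
-- A(0) is the 0×0 matrix; A(1) is then the 0×1 (empty) matrix.
Amat : (m : ℕ) → Matrix (s m) m
Amat zero () ()
Amat (suc k) r c with splitAt k r
Amat (suc k) r zero    | inj₁ _  = 1ℤ
Amat (suc k) r (suc j) | inj₁ r′ = - δ r′ j
Amat (suc k) r zero    | inj₂ _  = 0ℤ
Amat (suc k) r (suc j) | inj₂ r′ = Amat k r′ j

-- Block-diagonal (n·s(n)) × n² matrix with n diagonal blocks A(n).
-- Row index r = combine (block) (row within block), column likewise (0-based).
Ablock : (n : ℕ) → Matrix (n ℕ.* s n) (n ℕ.* n)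
Ablock n r c with quotient {n} (s n) r Fin.≟ quotient {n} n c
... | yes _ = Amat n (remainder {n} (s n) r) (remainder {n} n c)
... | no _  = 0ℤ

permCols : ∀ {r c} → Matrix r c → Permutation′ c → Matrix r c
permCols M π i j = M i (π ⟨$⟩ˡ j)

sumFin : ∀ {m} → (Fin m → ℤ) → ℤ
sumFin {zero} f = 0ℤ
sumFin {suc m} f = f zero ℤ.+ sumFin (λ i → f (suc i))

_·_ : ∀ {r c} → Matrix r c → (Fin c → ℤ) → (Fin r → ℤ)
(M · x) i = sumFin (λ j → M i j ℤ.* x j)

_<>0 : ∀ {m} → (Fin m → ℤ) → Set
y <>0 = ∀ i → y i ≢ 0ℤ

actVec : ∀ {m} → Permutation′ m → (Fin m → ℤ) → (Fin m → ℤ)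
actVec τ x i = x (τ ⟨$⟩ˡ i)

-- membership in the constraint set cs_π(j) = { π(i) | i in the j-th block of n consecutive indices }
-- (0-based: i lies in block j iff quotient n i ≡ j, i.e. j·n ≤ i < (j+1)·n)
InCS : (n : ℕ) → Permutation′ (n ℕ.* n) → Fin n → Fin (n ℕ.* n) → Set
InCS n π j a = Σ (Fin (n ℕ.* n)) λ i → (quotient {n} n i ≡ j) × (π ⟨$⟩ʳ i ≡ a)

Consistent : (n : ℕ) → Permutation′ (n ℕ.* n) → Permutation′ (n ℕ.* n) → Set
Consistent n π τ = ∀ (j : Fin n) (a : Fin (n ℕ.* n)) →
  (Σ (Fin (n ℕ.* n)) λ b → InCS n π j b × (τ ⟨$⟩ʳ b ≡ a)) ⇔ InCS n π j a

XConsistent : (n : ℕ) → Permutation′ (n ℕ.* n) → (Fin (n ℕ.* n) → ℤ) → Permutation′ (n ℕ.* n) → Set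
XConsistent n π x τ = ∀ (j : Fin n) (v : ℤ) →
  (Σ (Fin (n ℕ.* n)) λ i → InCS n π j i × (x (τ ⟨$⟩ˡ i) ≡ v))
    ⇔ (Σ (Fin (n ℕ.* n)) λ i → InCS n π j i × (x i ≡ v))

-- The solution set S(n,g) of the generalized Sudoku problem with data
-- π₁ π₂ π₃, k, index map idx : Fin k → Fin (n²) (l ↦ i_l), givens g : Fin k → ℤ (l ↦ g_{i_l}).
InS : (n : ℕ) (π₁ π₂ π₃ : Permutation′ (n ℕ.* n)) (k : ℕ)
      (idx : Fin k → Fin (n ℕ.* n)) (g : Fin k → ℤ) → (Fin (n ℕ.* n) → ℤ) → Set
InS n π₁ π₂ π₃ k idx g x =
  (∀ i → (1ℤ ℤ.≤ x i) × (x i ℤ.≤ + n))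
  × ((permCols (Ablock n) π₁ · x) <>0)
  × ((permCols (Ablock n) π₂ · x) <>0)
  × ((permCols (Ablock n) π₃ · x) <>0)
  × (∀ l → x (idx l) ≡ g l)

module Submission where

-- Every row of A(m) is a difference e_p − e_q of two unit vectors, and every
-- pair p ≠ q occurs (in some orientation).  Hence, for a vector of digits
-- (entries in 1..n), the constraint A_π x <> 0 says exactly that x is
-- injective on each constraint set of π, i.e. (pigeonhole) that each
-- constraint set carries every digit once ('nonzero⇔complete').
--   * If y = τ(x) with τ as described, the value sets of y agree with those of
--     x, so y satisfies all three constraint families, and the givens survive.
--   * Conversely, for solutions x and y, label each cell by (its π₁-constraint
--     set, its digit); this labelling is a bijection for both x and y, and
--     τ := (label of y)⁻¹ ∘ (label of x) has all the required properties.

open import Defs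
open import Data.Nat as ℕ using (ℕ; zero; suc; _≤_; _*_; s≤s; NonZero)
import Data.Nat.Properties as ℕP
open import Data.Nat.DivMod using (_mod_; m<n⇒m%n≡m)
open import Data.Fin as Fin using (Fin; zero; suc; toℕ; splitAt; combine; quotient; remainder; _↑ˡ_; _↑ʳ_)
import Data.Fin.Properties as FinP
open import Data.Fin.Permutation using (Permutation′; _⟨$⟩ʳ_; _⟨$⟩ˡ_; inverseˡ; inverseʳ; permutation; flip; _∘ₚ_)
open import Data.Integer as ℤ using (ℤ; +_; 0ℤ; 1ℤ; _-_; +≤+)
import Data.Integer.Properties as ℤP
open import Data.Integer.Tactic.RingSolver using (solve-∀)
open import Data.Product using (Σ; ∃; ∃₂; _×_; _,_; proj₁; proj₂)
open import Data.Sum using (_⊎_; inj₁; inj₂)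
open import Relation.Binary.PropositionalEquality
open import Relation.Nullary using (yes; no; contradiction)
open import Function.Base using (_∘_)
open import Function.Definitions using (Injective)
open import Function.Bundles using (_⇔_; mk⇔; Equivalence)
import Function.Properties.Equivalence as ⇔

open ≡-Reasoning

δ-diag : ∀ {m} (i : Fin m) → δ i i ≡ 1ℤ
δ-diag i with i Fin.≟ i
... | yes _ = refl
... | no i≢i = contradiction refl i≢i

δ-off : ∀ {m} {i j : Fin m} → i ≢ j → δ i j ≡ 0ℤ
δ-off {i = i} {j} i≢j with i Fin.≟ j
... | yes i≡j = contradiction i≡j i≢j
... | no _ = refl

δ-injective : ∀ {m m′} {f : Fin m → Fin m′} → Injective _≡_ _≡_ f →
              ∀ i j → δ (f i) (f j) ≡ δ i j
δ-injective {f = f} f-inj i j with i Fin.≟ j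
... | yes refl = δ-diag (f i)
... | no i≢j = δ-off (i≢j ∘ f-inj)

sumFin-cong : ∀ {m} {f g : Fin m → ℤ} → (∀ j → f j ≡ g j) → sumFin f ≡ sumFin g
sumFin-cong {zero} f≗g = refl
sumFin-cong {suc m} f≗g = cong₂ ℤ._+_ (f≗g zero) (sumFin-cong (f≗g ∘ suc))

sumFin-zero : ∀ {m} (f : Fin m → ℤ) → (∀ j → f j ≡ 0ℤ) → sumFin f ≡ 0ℤ
sumFin-zero {zero} f f≗0 = refl
sumFin-zero {suc m} f f≗0 = cong₂ ℤ._+_ (f≗0 zero) (sumFin-zero (f ∘ suc) (f≗0 ∘ suc))

sumFin-δ : ∀ {m} (p : Fin m) (x : Fin m → ℤ) → sumFin (λ j → δ p j ℤ.* x j) ≡ x p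
sumFin-δ {suc m} zero x = begin
  1ℤ ℤ.* x zero ℤ.+ sumFin (λ j → 0ℤ ℤ.* x (suc j))
    ≡⟨ cong (λ rest → 1ℤ ℤ.* x zero ℤ.+ rest) (sumFin-zero {m} _ (λ _ → refl)) ⟩
  1ℤ ℤ.* x zero ℤ.+ 0ℤ ≡⟨ ℤP.+-identityʳ _ ⟩
  1ℤ ℤ.* x zero        ≡⟨ ℤP.*-identityˡ (x zero) ⟩
  x zero               ∎
sumFin-δ {suc m} (suc p) x = begin
  0ℤ ℤ.+ sumFin (λ j → δ (suc p) (suc j) ℤ.* x (suc j))
    ≡⟨ ℤP.+-identityˡ _ ⟩
  sumFin (λ j → δ (suc p) (suc j) ℤ.* x (suc j))
    ≡⟨ sumFin-cong (λ j → cong (ℤ._* x (suc j)) (δ-injective FinP.suc-injective p j)) ⟩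
  sumFin (λ j → δ p j ℤ.* x (suc j)) ≡⟨ sumFin-δ p (x ∘ suc) ⟩
  x (suc p)                          ∎

sub-interchange : ∀ a b c d → (a - b) ℤ.+ (c - d) ≡ (a ℤ.+ c) - (b ℤ.+ d)
sub-interchange = solve-∀

sub-distribʳ : ∀ a b c → (a - b) ℤ.* c ≡ a ℤ.* c - b ℤ.* c
sub-distribʳ = solve-∀

sumFin-sub : ∀ {m} (f g : Fin m → ℤ) → sumFin (λ j → f j - g j) ≡ sumFin f - sumFin g
sumFin-sub {zero} f g = refl
sumFin-sub {suc m} f g =
  trans (cong (λ rest → (f zero - g zero) ℤ.+ rest) (sumFin-sub (f ∘ suc) (g ∘ suc)))
        (sub-interchange (f zero) (g zero) _ _)

DiffRow : ∀ {r c} → Matrix r c → Fin r → Fin c → Fin c → Set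
DiffRow M r p q = ∀ j → M r j ≡ δ p j - δ q j

diffRow-· : ∀ {r c} (M : Matrix r c) {R p q} → DiffRow M R p q →
            ∀ x → (M · x) R ≡ x p - x q
diffRow-· M {R} {p} {q} row x = begin
  sumFin (λ j → M R j ℤ.* x j)
    ≡⟨ sumFin-cong (λ j → trans (cong (ℤ._* x j) (row j)) (sub-distribʳ (δ p j) (δ q j) (x j))) ⟩
  sumFin (λ j → δ p j ℤ.* x j - δ q j ℤ.* x j)
    ≡⟨ sumFin-sub (λ j → δ p j ℤ.* x j) (λ j → δ q j ℤ.* x j) ⟩
  sumFin (λ j → δ p j ℤ.* x j) - sumFin (λ j → δ q j ℤ.* x j)
    ≡⟨ cong₂ _-_ (sumFin-δ p x) (sumFin-δ q x) ⟩
  x p - x q ∎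

permCols-row : ∀ {r c} {M : Matrix r c} (π : Permutation′ c) {R a b} →
               DiffRow M R (π ⟨$⟩ˡ a) (π ⟨$⟩ˡ b) → DiffRow (permCols M π) R a b
permCols-row π {a = a} {b} row j =
  trans (row (π ⟨$⟩ˡ j)) (cong₂ _-_ (δ-injective from-injective a j) (δ-injective from-injective b j))
  where
  from-injective : Injective _≡_ _≡_ (π ⟨$⟩ˡ_)
  from-injective {u} {v} e = trans (sym (inverseʳ π)) (trans (cong (π ⟨$⟩ʳ_) e) (inverseʳ π))

top-row : ∀ k {r} {j : Fin k} → splitAt k r ≡ inj₁ j → DiffRow (Amat (suc k)) r zero (suc j)
top-row k split zero rewrite split = refl
top-row k {j = j} split (suc c) rewrite split = begin
  ℤ.- δ j c                   ≡⟨ ℤP.+-identityˡ _ ⟨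
  0ℤ - δ j c                  ≡⟨ cong (0ℤ -_) (δ-injective FinP.suc-injective j c) ⟨
  0ℤ - δ (suc j) (suc c)      ∎

lower-row : ∀ k {r} {r′ : Fin (s k)} {p q} → splitAt k r ≡ inj₂ r′ →
            DiffRow (Amat k) r′ p q → DiffRow (Amat (suc k)) r (suc p) (suc q)
lower-row k split row zero rewrite split = refl
lower-row k {p = p} {q} split row (suc c) rewrite split =
  trans (row c) (sym (cong₂ _-_ (δ-injective FinP.suc-injective p c) (δ-injective FinP.suc-injective q c)))

Amat-row : ∀ m (r : Fin (s m)) → ∃₂ λ p q → p ≢ q × DiffRow (Amat m) r p q
Amat-row (suc k) r = classify (splitAt k r) refl
  where
  classify : ∀ half → splitAt k r ≡ half → ∃₂ λ p q → p ≢ q × DiffRow (Amat (suc k)) r p q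
  classify (inj₁ j) split = zero , suc j , (λ ()) , top-row k split
  classify (inj₂ r′) split with Amat-row k r′
  ... | p , q , p≢q , row = suc p , suc q , p≢q ∘ FinP.suc-injective , lower-row k split row

Amat-pair : ∀ m (p q : Fin m) → p ≢ q →
            ∃ λ r → DiffRow (Amat m) r p q ⊎ DiffRow (Amat m) r q p
Amat-pair (suc k) zero zero p≢q = contradiction refl p≢q
Amat-pair (suc k) zero (suc j) _ = j ↑ˡ s k , inj₁ (top-row k (FinP.splitAt-↑ˡ k j (s k)))
Amat-pair (suc k) (suc j) zero _ = j ↑ˡ s k , inj₂ (top-row k (FinP.splitAt-↑ˡ k j (s k)))
Amat-pair (suc k) (suc p) (suc q) p≢q with Amat-pair k p q (p≢q ∘ cong suc)
... | r , inj₁ row = k ↑ʳ r , inj₁ (lower-row k (FinP.splitAt-↑ʳ k (s k) r) row)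
... | r , inj₂ row = k ↑ʳ r , inj₂ (lower-row k (FinP.splitAt-↑ʳ k (s k) r) row)

injective⇒surjective : ∀ {m} {f : Fin m → Fin m} → Injective _≡_ _≡_ f →
                       ∀ v → ∃ λ i → f i ≡ v
injective⇒surjective {suc m} {f} f-inj v with FinP.any? (λ i → f i Fin.≟ v)
... | yes hit = hit
... | no miss = contradiction (FinP.injective⇒≤ squeeze-injective) ℕP.1+n≰n
  where
  -- if v were missed, f would squeeze Fin (m+1) injectively into Fin m
  squeeze : Fin (suc m) → Fin m
  squeeze i = Fin.punchOut {i = v} {j = f i} (λ v≡fi → miss (i , sym v≡fi))
  squeeze-injective : Injective _≡_ _≡_ squeeze
  squeeze-injective {a} {b} e =
    f-inj (FinP.punchOut-injective (λ v≡fa → miss (a , sym v≡fa)) (λ v≡fb → miss (b , sym v≡fb)) e)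

surjective⇒injective : ∀ {m} {f : Fin m → Fin m} → (∀ v → ∃ λ i → f i ≡ v) →
                       Injective _≡_ _≡_ f
surjective⇒injective {m} {f} f-surj {a} {b} fa≡fb = begin
  a             ≡⟨ retract a ⟨
  section (f a) ≡⟨ cong section fa≡fb ⟩
  section (f b) ≡⟨ retract b ⟩
  b             ∎
  where
  section : Fin m → Fin m
  section v = proj₁ (f-surj v)
  section-injective : Injective _≡_ _≡_ section
  section-injective {u} {v} e = trans (sym (proj₂ (f-surj u))) (trans (cong f e) (proj₂ (f-surj v)))
  -- the section is itself onto, hence a two-sided inverse of f
  retract : ∀ i → section (f i) ≡ i
  retract i with injective⇒surjective section-injective i
  ... | i′ , refl = cong section (proj₂ (f-surj i′))

injective⇒permutation : ∀ {m} (f : Fin m → Fin m) → Injective _≡_ _≡_ f → Permutation′ m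
injective⇒permutation {m} f f-inj =
  permutation f (proj₁ ∘ surj) (proj₂ ∘ surj) (λ i → f-inj (proj₂ (surj (f i))))
  where
  surj : ∀ v → ∃ λ i → f i ≡ v
  surj = injective⇒surjective f-inj

module Digits (n : ℕ) .{{_ : NonZero n}} where

  IsDigit : ℤ → Set
  IsDigit v = (1ℤ ℤ.≤ v) × (v ℤ.≤ + n)

  -- d : Fin n names the digit d + 1 ...
  value : Fin n → ℤ
  value d = + suc (toℕ d)

  -- ... and a digit v is named by v − 1 (the name of a non-digit is irrelevant)
  digit : ℤ → Fin n
  digit v = (ℤ.∣ v ∣ ℕ.∸ 1) mod n

  value-isDigit : ∀ d → IsDigit (value d)
  value-isDigit d = +≤+ (s≤s ℕ.z≤n) , +≤+ (FinP.toℕ<n d)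

  digit-value : ∀ d → digit (value d) ≡ d
  digit-value d = FinP.toℕ-injective (trans (FinP.toℕ-fromℕ< _) (m<n⇒m%n≡m (FinP.toℕ<n d)))

  value-digit : ∀ {v} → IsDigit v → value (digit v) ≡ v
  value-digit {+ suc k} (_ , +≤+ k<n) =
    cong (λ t → + suc t) (trans (FinP.toℕ-fromℕ< _) (m<n⇒m%n≡m k<n))
  value-digit {+ zero} (+≤+ () , _)

  digit-injective : ∀ {u v} → IsDigit u → IsDigit v → digit u ≡ digit v → u ≡ v
  digit-injective {u} {v} u-digit v-digit e = begin
    u               ≡⟨ value-digit u-digit ⟨
    value (digit u) ≡⟨ cong value e ⟩
    value (digit v) ≡⟨ value-digit v-digit ⟩
    v               ∎

module Sudoku (n : ℕ) .{{_ : NonZero n}} where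
  open Digits n

  Cell : Set
  Cell = Fin (n * n)

  Perm : Set
  Perm = Permutation′ (n * n)

  Digits : (Cell → ℤ) → Set
  Digits x = ∀ i → IsDigit (x i)

  colBlock colSlot : Cell → Fin n
  colBlock = quotient {n} n
  colSlot = remainder {n} n

  rowBlock : Fin (n * s n) → Fin n
  rowBlock = quotient {n} (s n)

  rowSlot : Fin (n * s n) → Fin (s n)
  rowSlot = remainder {n} (s n)

  δ-sameBlock : ∀ {a c} → colBlock a ≡ colBlock c → δ (colSlot a) (colSlot c) ≡ δ a c
  δ-sameBlock {a} {c} same with a Fin.≟ c
  ... | yes refl = δ-diag (colSlot a)
  ... | no a≢c = δ-off λ slots → a≢c (begin
    a                                ≡⟨ FinP.combine-remQuot {n} n a ⟨
    combine (colBlock a) (colSlot a) ≡⟨ cong₂ combine same slots ⟩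
    combine (colBlock c) (colSlot c) ≡⟨ FinP.combine-remQuot {n} n c ⟩
    c                                ∎)

  Ablock-row : ∀ R {a b} → colBlock a ≡ rowBlock R → colBlock b ≡ rowBlock R →
               DiffRow (Amat n) (rowSlot R) (colSlot a) (colSlot b) → DiffRow (Ablock n) R a b
  Ablock-row R {a} {b} a∈R b∈R row c with quotient {n} (s n) R Fin.≟ quotient {n} n c
  ... | yes R∋c = trans (row (colSlot c))
          (cong₂ _-_ (δ-sameBlock (trans a∈R R∋c)) (δ-sameBlock (trans b∈R R∋c)))
  ... | no R∌c = sym (cong₂ _-_ (δ-off (outside a∈R)) (δ-off (outside b∈R)))
    where
    outside : ∀ {u} → colBlock u ≡ rowBlock R → u ≢ c
    outside u∈R refl = R∌c (sym u∈R)

  Aπ : Perm → Matrix (n * s n) (n * n)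
  Aπ π = permCols (Ablock n) π

  cell : Perm → Fin n → Fin n → Cell
  cell π j t = π ⟨$⟩ʳ combine j t

  block slot : Perm → Cell → Fin n
  block π a = colBlock (π ⟨$⟩ˡ a)
  slot π a = colSlot (π ⟨$⟩ˡ a)

  block-cell : ∀ π j t → block π (cell π j t) ≡ j
  block-cell π j t = trans (cong colBlock (inverseˡ π)) (cong proj₁ (FinP.remQuot-combine {n} {n} j t))

  slot-cell : ∀ π j t → slot π (cell π j t) ≡ t
  slot-cell π j t = trans (cong colSlot (inverseˡ π)) (cong proj₂ (FinP.remQuot-combine {n} {n} j t))

  cell-slot : ∀ π {j a} → block π a ≡ j → cell π j (slot π a) ≡ a
  cell-slot π {a = a} refl =
    trans (cong (π ⟨$⟩ʳ_) (FinP.combine-remQuot {n} n (π ⟨$⟩ˡ a))) (inverseʳ π)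

  cell-injective : ∀ π {j t u} → cell π j t ≡ cell π j u → t ≡ u
  cell-injective π {j} {t} {u} e = trans (sym (slot-cell π j t)) (trans (cong (slot π) e) (slot-cell π j u))

  slot-injective : ∀ π {a b} → block π a ≡ block π b → slot π a ≡ slot π b → a ≡ b
  slot-injective π {a} {b} same slots = begin
    a                             ≡⟨ cell-slot π refl ⟨
    cell π (block π a) (slot π a) ≡⟨ cong (cell π (block π a)) slots ⟩
    cell π (block π a) (slot π b) ≡⟨ cell-slot π (sym same) ⟩
    b                             ∎

  InCS⇒block : ∀ π {j a} → InCS n π j a → block π a ≡ j
  InCS⇒block π (i , i∈j , refl) = trans (cong colBlock (inverseˡ π)) i∈j

  block⇒InCS : ∀ π {j a} → block π a ≡ j → InCS n π j a
  block⇒InCS π {a = a} a∈j = π ⟨$⟩ˡ a , a∈j , inverseʳ π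

  lift-row : ∀ π j r {a b} → block π a ≡ j → block π b ≡ j →
             DiffRow (Amat n) r (slot π a) (slot π b) → DiffRow (Aπ π) (combine j r) a b
  lift-row π j r {a} {b} a∈j b∈j row =
    permCols-row {M = Ablock n} π
      (Ablock-row (combine j r) (trans a∈j (sym rowBlock-R)) (trans b∈j (sym rowBlock-R))
        (subst (λ r′ → DiffRow (Amat n) r′ (slot π a) (slot π b)) (sym rowSlot-R) row))
    where
    rowBlock-R : rowBlock (combine j r) ≡ j
    rowBlock-R = cong proj₁ (FinP.remQuot-combine {n} {s n} j r)
    rowSlot-R : rowSlot (combine j r) ≡ r
    rowSlot-R = cong proj₂ (FinP.remQuot-combine {n} {s n} j r)

  constraintRow : ∀ π R → ∃₂ λ a b → a ≢ b × block π a ≡ block π b ×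
                  DiffRow (Aπ π) R a b
  constraintRow π R with Amat-row n (rowSlot R)
  ... | p , q , p≢q , row =
    a , b , p≢q ∘ cell-injective π ,
    trans (block-cell π j p) (sym (block-cell π j q)) ,
    subst (λ R′ → DiffRow (Aπ π) R′ a b) (FinP.combine-remQuot {n} (s n) R)
      (lift-row π j (rowSlot R) (block-cell π j p) (block-cell π j q)
        (subst₂ (DiffRow (Amat n) (rowSlot R)) (sym (slot-cell π j p)) (sym (slot-cell π j q)) row))
    where
    j : Fin n
    j = rowBlock R
    a b : Cell
    a = cell π j p
    b = cell π j q

  constraintPair : ∀ π {a b} → a ≢ b → block π a ≡ block π b →
                   ∃ λ R → DiffRow (Aπ π) R a b ⊎ DiffRow (Aπ π) R b a
  constraintPair π {a} {b} a≢b same with Amat-pair n (slot π a) (slot π b) (a≢b ∘ slot-injective π same)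
  ... | r , inj₁ row = combine (block π a) r , inj₁ (lift-row π _ r refl (sym same) row)
  ... | r , inj₂ row = combine (block π a) r , inj₂ (lift-row π _ r (sym same) refl row)

  Latin : Perm → (Cell → ℤ) → Set
  Latin π x = ∀ {a b} → block π a ≡ block π b → x a ≡ x b → a ≡ b

  latin⇒nonzero : ∀ π {x} → Latin π x → (Aπ π · x) <>0
  latin⇒nonzero π {x} latin R Ax≡0 with constraintRow π R
  ... | a , b , a≢b , same , row =
    a≢b (latin same (ℤP.i-j≡0⇒i≡j (x a) (x b) (trans (sym (diffRow-· (Aπ π) row x)) Ax≡0)))

  nonzero⇒latin : ∀ π {x} → (Aπ π · x) <>0 → Latin π x
  nonzero⇒latin π {x} nonzero {a} {b} same xa≡xb with a Fin.≟ b
  ... | yes a≡b = a≡b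
  ... | no a≢b with constraintPair π a≢b same
  ...   | R , inj₁ row = contradiction (trans (diffRow-· (Aπ π) row x) (ℤP.i≡j⇒i-j≡0 xa≡xb)) (nonzero R)
  ...   | R , inj₂ row = contradiction (trans (diffRow-· (Aπ π) row x) (ℤP.i≡j⇒i-j≡0 (sym xa≡xb))) (nonzero R)

  -- The values x takes on the j-th constraint set of π.  Note that
  -- XConsistent n π x τ says  ValuesOn π (actVec τ x) j ⇔ ValuesOn π x j.
  ValuesOn : Perm → (Cell → ℤ) → Fin n → ℤ → Set
  ValuesOn π x j v = Σ Cell λ i → InCS n π j i × x i ≡ v

  Complete : Perm → (Cell → ℤ) → Set
  Complete π x = ∀ j v → ValuesOn π x j v ⇔ IsDigit v

  digitsOn : Perm → (Cell → ℤ) → Fin n → Fin n → Fin n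
  digitsOn π x j t = digit (x (cell π j t))

  latin⇒complete : ∀ π {x} → Digits x → Latin π x → Complete π x
  latin⇒complete π {x} x-digits latin j v = mk⇔ (λ (i , _ , xi≡v) → subst IsDigit xi≡v (x-digits i)) attained
    where
    -- injective, hence onto by pigeonhole
    digitsOn-injective : Injective _≡_ _≡_ (digitsOn π x j)
    digitsOn-injective {t} {u} e = cell-injective π
      (latin (trans (block-cell π j t) (sym (block-cell π j u))) (digit-injective (x-digits _) (x-digits _) e))
    attained : IsDigit v → ValuesOn π x j v
    attained v-digit with injective⇒surjective digitsOn-injective (digit v)
    ... | t , e = cell π j t , block⇒InCS π (block-cell π j t) ,
                  digit-injective (x-digits _) v-digit e

  complete⇒latin : ∀ π {x} → Digits x → Complete π x → Latin π x
  complete⇒latin π {x} x-digits complete {a} {b} same xa≡xb = slot-injective π same slots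
    where
    j : Fin n
    j = block π a
    -- every digit occurs on constraint set j, so digitsOn is onto, hence injective
    digitsOn-onto : ∀ d → ∃ λ t → digitsOn π x j t ≡ d
    digitsOn-onto d with Equivalence.from (complete j (value d)) (value-isDigit d)
    ... | i , i∈j , xi≡d = slot π i , (begin
      digit (x (cell π j (slot π i))) ≡⟨ cong (digit ∘ x) (cell-slot π (InCS⇒block π i∈j)) ⟩
      digit (x i)                     ≡⟨ cong digit xi≡d ⟩
      digit (value d)                 ≡⟨ digit-value d ⟩
      d                               ∎)
    slots : slot π a ≡ slot π b
    slots = surjective⇒injective digitsOn-onto (cong digit (begin
      x (cell π j (slot π a)) ≡⟨ cong x (cell-slot π refl) ⟩
      x a                     ≡⟨ xa≡xb ⟩
      x b                     ≡⟨ cong x (cell-slot π (sym same)) ⟨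
      x (cell π j (slot π b)) ∎))

  nonzero⇔complete : ∀ π {x} → Digits x → (Aπ π · x) <>0 ⇔ Complete π x
  nonzero⇔complete π x-digits =
    mk⇔ (latin⇒complete π x-digits ∘ nonzero⇒latin π) (latin⇒nonzero π ∘ complete⇒latin π x-digits)

  ValuesOn-cong : ∀ π {x y} → (∀ i → x i ≡ y i) → ∀ j v → ValuesOn π x j v ⇔ ValuesOn π y j v
  ValuesOn-cong π x≗y j v =
    mk⇔ (λ (i , i∈j , e) → i , i∈j , trans (sym (x≗y i)) e) (λ (i , i∈j , e) → i , i∈j , trans (x≗y i) e)

  xConsistent⇒complete : ∀ π {x y} (τ : Perm) → (∀ i → y i ≡ actVec τ x i) →
                         XConsistent n π x τ → Complete π x → Complete π y
  xConsistent⇒complete π τ y≗τx consistent complete j v =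
    ⇔.trans (ValuesOn-cong π y≗τx j v) (⇔.trans (consistent j v) (complete j v))

  complete⇒xConsistent : ∀ π {x y} (τ : Perm) → (∀ i → y i ≡ actVec τ x i) →
                         Complete π x → Complete π y → XConsistent n π x τ
  complete⇒xConsistent π τ y≗τx x-complete y-complete j v =
    ⇔.trans (ValuesOn-cong π (sym ∘ y≗τx) j v) (⇔.trans (y-complete j v) (⇔.sym (x-complete j v)))

  consistent⇒xConsistent : ∀ π {x} (τ : Perm) → Consistent n π τ → XConsistent n π x τ
  consistent⇒xConsistent π {x} τ consistent j v = mk⇔ to from
    where
    to : ValuesOn π (actVec τ x) j v → ValuesOn π x j v
    to (i , i∈j , e) with Equivalence.from (consistent j i) i∈j
    ... | b , b∈j , refl = b , b∈j , trans (cong x (sym (inverseˡ τ))) e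
    from : ValuesOn π x j v → ValuesOn π (actVec τ x) j v
    from (i , i∈j , e) = τ ⟨$⟩ʳ i , Equivalence.to (consistent j (τ ⟨$⟩ʳ i)) (i , i∈j , refl) ,
                         trans (cong x (inverseˡ τ)) e

  blockPreserving⇒consistent : ∀ π (τ : Perm) → (∀ a → block π (τ ⟨$⟩ʳ a) ≡ block π a) →
                               Consistent n π τ
  blockPreserving⇒consistent π τ preserves j a = mk⇔ to from
    where
    to : (Σ Cell λ b → InCS n π j b × τ ⟨$⟩ʳ b ≡ a) → InCS n π j a
    to (b , b∈j , refl) = block⇒InCS π (trans (preserves b) (InCS⇒block π b∈j))
    from : InCS n π j a → Σ Cell λ b → InCS n π j b × τ ⟨$⟩ʳ b ≡ a
    from a∈j = τ ⟨$⟩ˡ a , block⇒InCS π (begin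
      block π (τ ⟨$⟩ˡ a)              ≡⟨ preserves (τ ⟨$⟩ˡ a) ⟨
      block π (τ ⟨$⟩ʳ (τ ⟨$⟩ˡ a))      ≡⟨ cong (block π) (inverseʳ τ) ⟩
      block π a                       ≡⟨ InCS⇒block π a∈j ⟩
      j                               ∎) , inverseʳ τ

  label : Perm → (Cell → ℤ) → Cell → Cell
  label π x a = combine (block π a) (digit (x a))

  label-block : ∀ π x y {a b} → label π x a ≡ label π y b → block π a ≡ block π b
  label-block π x y {a} {b} = FinP.combine-injectiveˡ (block π a) (digit (x a)) (block π b) (digit (y b))

  label-digit : ∀ π x y {a b} → label π x a ≡ label π y b → digit (x a) ≡ digit (y b)
  label-digit π x y {a} {b} = FinP.combine-injectiveʳ (block π a) (digit (x a)) (block π b) (digit (y b))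

  label-injective : ∀ π {x} → Digits x → Latin π x → Injective _≡_ _≡_ (label π x)
  label-injective π {x} x-digits latin {a} {b} e =
    latin (label-block π x x e) (digit-injective (x-digits a) (x-digits b) (label-digit π x x e))

  -- Given two Latin vectors of digits x and y, the relabelling τ sends each
  -- cell to the cell of the same π-constraint set whose y-digit is its x-digit.
  module Relabelling (π : Perm) {x y : Cell → ℤ}
                     (x-digits : Digits x) (x-latin : Latin π x)
                     (y-digits : Digits y) (y-latin : Latin π y) where

    labelsˣ labelsʸ : Perm
    labelsˣ = injective⇒permutation (label π x) (label-injective π x-digits x-latin)
    labelsʸ = injective⇒permutation (label π y) (label-injective π y-digits y-latin)

    τ : Perm
    τ = labelsˣ ∘ₚ flip labelsʸ

    τ-label : ∀ a → label π y (τ ⟨$⟩ʳ a) ≡ label π x a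
    τ-label a = inverseʳ labelsʸ

    τ⁻¹-label : ∀ a → label π x (τ ⟨$⟩ˡ a) ≡ label π y a
    τ⁻¹-label a = inverseʳ labelsˣ

    moves-x-to-y : ∀ a → y a ≡ actVec τ x a
    moves-x-to-y a = digit-injective (y-digits a) (x-digits _)
      (sym (label-digit π x y (τ⁻¹-label a)))

    preserves-blocks : ∀ a → block π (τ ⟨$⟩ʳ a) ≡ block π a
    preserves-blocks a = label-block π y x (τ-label a)

    fixes-agreement : ∀ {a} → x a ≡ y a → τ ⟨$⟩ʳ a ≡ a
    fixes-agreement {a} xa≡ya = begin
      labelsʸ ⟨$⟩ˡ label π x a ≡⟨ cong (λ v → labelsʸ ⟨$⟩ˡ combine (block π a) (digit v)) xa≡ya ⟩
      labelsʸ ⟨$⟩ˡ label π y a ≡⟨ inverseˡ labelsʸ ⟩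
      a                       ∎

  module _ (π₁ π₂ π₃ : Perm) (k : ℕ) (idx : Fin k → Cell) (g : Fin k → ℤ) where

    Admissible : (Cell → ℤ) → (Cell → ℤ) → Perm → Set
    Admissible x y τ = (∀ i → y i ≡ actVec τ x i) × Consistent n π₁ τ × XConsistent n π₂ x τ
                       × XConsistent n π₃ x τ × (∀ l → τ ⟨$⟩ʳ idx l ≡ idx l)

    solutions-related : ∀ {x y} → InS n π₁ π₂ π₃ k idx g x → InS n π₁ π₂ π₃ k idx g y →
                        Σ Perm (Admissible x y)
    solutions-related {x} {y} (x-digits , x₁ , x₂ , x₃ , x-givens) (y-digits , y₁ , y₂ , y₃ , y-givens) =
      τ , moves-x-to-y , blockPreserving⇒consistent π₁ τ preserves-blocks ,
      xConsistent π₂ x₂ y₂ , xConsistent π₃ x₃ y₃ ,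
      (λ l → fixes-agreement (trans (x-givens l) (sym (y-givens l))))
      where
      open Relabelling π₁ x-digits (nonzero⇒latin π₁ x₁) y-digits (nonzero⇒latin π₁ y₁)
      xConsistent : ∀ π → (Aπ π · x) <>0 → (Aπ π · y) <>0 → XConsistent n π x τ
      xConsistent π x-ok y-ok = complete⇒xConsistent π τ moves-x-to-y
        (Equivalence.to (nonzero⇔complete π x-digits) x-ok) (Equivalence.to (nonzero⇔complete π y-digits) y-ok)

    admissible-image : ∀ {x y} τ → InS n π₁ π₂ π₃ k idx g x → Admissible x y τ → InS n π₁ π₂ π₃ k idx g y
    admissible-image {x} {y} τ (x-digits , x₁ , x₂ , x₃ , x-givens) (y≗τx , consistent₁ , consistent₂ , consistent₃ , fixes) =
      y-digits , transfer π₁ x₁ (consistent⇒xConsistent π₁ τ consistent₁) ,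
      transfer π₂ x₂ consistent₂ , transfer π₃ x₃ consistent₃ , y-givens
      where
      y-digits : Digits y
      y-digits i = subst IsDigit (sym (y≗τx i)) (x-digits _)
      transfer : ∀ π → (Aπ π · x) <>0 → XConsistent n π x τ → (Aπ π · y) <>0
      transfer π x-ok consistent = Equivalence.from (nonzero⇔complete π y-digits)
        (xConsistent⇒complete π τ y≗τx consistent (Equivalence.to (nonzero⇔complete π x-digits) x-ok))
      y-givens : ∀ l → y (idx l) ≡ g l
      y-givens l = begin
        y (idx l)               ≡⟨ y≗τx (idx l) ⟩
        x (τ ⟨$⟩ˡ idx l)         ≡⟨ cong (λ c → x (τ ⟨$⟩ˡ c)) (fixes l) ⟨
        x (τ ⟨$⟩ˡ (τ ⟨$⟩ʳ idx l)) ≡⟨ cong x (inverseˡ τ) ⟩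
        x (idx l)               ≡⟨ x-givens l ⟩
        g l                     ∎

-- Theorem 4.2.
theorem4p2 : (n : ℕ) → 2 ≤ n →
    (π₁ π₂ π₃ : Permutation′ (n * n)) →
    (k : ℕ) → k ≤ n * n →
    (idx : Fin k → Fin (n * n)) → Injective _≡_ _≡_ idx →
    (g : Fin k → ℤ) → (∀ l → (1ℤ ℤ.≤ g l) × (g l ℤ.≤ + n)) →
    (x : Fin (n * n) → ℤ) → InS n π₁ π₂ π₃ k idx g x →
    (y : Fin (n * n) → ℤ) →
    InS n π₁ π₂ π₃ k idx g y
      ⇔ (Σ (Permutation′ (n * n)) λ τ →
           (∀ i → y i ≡ actVec τ x i)
           × Consistent n π₁ τ
           × XConsistent n π₂ x τ
           × XConsistent n π₃ x τ
           × (∀ l → τ ⟨$⟩ʳ idx l ≡ idx l))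
theorem4p2 n@(suc _) _ π₁ π₂ π₃ k _ idx _ g _ x x-solution y =
  mk⇔ (solutions-related π₁ π₂ π₃ k idx g x-solution)
      (λ (τ , admissible) → admissible-image π₁ π₂ π₃ k idx g τ x-solution admissible)
  where open Sudoku n
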